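{- Let $\pi$ be a permutation of length $n$ of the form $\pi=(n-2)\,\alpha\,(n-1)\,n$. Then \[B^{ -1}(\mathrm{Av}(\pi))=\mathrm{Av}\big((n-2)\,(n-1)\,\alpha\,n,\ (n-1)\,(n-2)\,\alpha\,n,\ (n-2)\,n\,\alpha\,(n-1),\ n\,(n-2)\,\alpha\,(n-1)\big).\]
   Context: Permutations are sequences of length $n\ge1$ using each of $1,\ldots,n$ once. For any finite sequence of distinct numbers, $B$ is defined recursively by $B(\epsilon)=\epsilon$ and, writing a non-empty sequence as $\sigma=\sigma_1 m\sigma_2$ with $m$ its largest term, $B(\sigma)=B(\sigma_1)\sigma_2 m$. $\mathrm{Av}(M)$ is the set of permutations having no (not necessarily consecutive) subsequence order isomorphic to any element of $M$. $B^{ -1}(X)=\{\sigma:B(\sigma)\in X\}$. -}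

module Defs where

open import Data.Nat using (ℕ; zero; suc; _<_; _≤ᵇ_; _⊔_)
open import Data.Bool using (true; false; if_then_else_)
open import Data.List using (List; []; _∷_; _++_; length; lookup; map; upTo; foldr)
open import Data.List.Relation.Binary.Sublist.Propositional using (_⊆_)
open import Data.List.Relation.Binary.Permutation.Propositional using (_↭_)
open import Data.List.Relation.Unary.All using (All)
open import Data.Fin using (Fin; cast)
open import Data.Product using (Σ; ∃; _×_; _,_)
open import Relation.Binary.PropositionalEquality using (_≡_)
open import Relation.Nullary using (¬_)
open import Function.Bundles using (_⇔_)

oneTo : ℕ → List ℕ
oneTo n = map suc (upTo n)

IsPerm : ℕ → List ℕ → Set
IsPerm n σ = σ ↭ oneTo n

OrderIso : List ℕ → List ℕ → Set
OrderIso xs ys = Σ (length xs ≡ length ys) λ eq →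
  ∀ (i j : Fin (length xs)) →
    (lookup xs i < lookup xs j) ⇔ (lookup ys (cast eq i) < lookup ys (cast eq j))

Contains : List ℕ → List ℕ → Set
Contains σ p = ∃ λ τ → (τ ⊆ σ) × OrderIso τ p

Avoids : List (List ℕ) → List ℕ → Set
Avoids M σ = All (λ p → ¬ Contains σ p) M

-- maximum of a list (0 for empty; entries of permutations are ≥ 1)
maxL : List ℕ → ℕ
maxL = foldr _⊔_ 0

splitAt : ℕ → List ℕ → List ℕ × List ℕ
splitAt m [] = [] , []
splitAt m (x ∷ xs) with (m ≤ᵇ x) Data.Bool.∧ (x ≤ᵇ m)
... | true  = [] , xs
... | false with splitAt m xs
...   | (l , r) = (x ∷ l) , r

-- B with fuel (fuel = length suffices since σ₁ is strictly shorter)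
Bf : ℕ → List ℕ → List ℕ
Bf zero σ = []
Bf (suc k) [] = []
Bf (suc k) (x ∷ xs) with splitAt (maxL (x ∷ xs)) (x ∷ xs)
... | (σ₁ , σ₂) = Bf k σ₁ ++ (σ₂ ++ (maxL (x ∷ xs) ∷ []))

-- B(ε) = ε, B(σ₁ m σ₂) = B(σ₁) σ₂ m
B : List ℕ → List ℕ
B σ = Bf (length σ) σ

-- B is one pass of bubble sort: scanning left to right with the running maximum, the smaller of
-- the maximum and the next entry is output, and the maximum itself comes out last. Hence B σ
-- contains π = (n-2) α (n-1) n, realised as x A y z with A ≅ α below x < y < z, iff σ splits as
-- U V W where U holds x and some larger e (so x is output while the maximum exceeds x), V holds A
-- (which, lying below the maximum, passes through unchanged) and W holds some f > x (which,
-- together with the final maximum, yields y < z). The four patterns of the statement are the two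
-- orders of x and e inside U combined with the two orders of e and f.
module Submission where

open import Defs
open import Data.Bool using (true; false; T; _∧_)
open import Data.Bool.Properties using (T-∧)
open import Data.Empty using (⊥; ⊥-elim)
open import Data.Fin using (zero; suc; cast)
open import Data.Fin.Properties using (toℕ-cast; toℕ-injective)
open import Data.List using (List; []; _∷_; _++_; length; lookup)
open import Data.List.Properties
  using (++-assoc; ∷-injective; ∷-injectiveʳ; ++-conicalʳ; length-++-≤ˡ; length-++-sucʳ)
open import Data.List.Membership.Propositional using (_∈_)
open import Data.List.Membership.Propositional.Properties using (∈-++⁺ˡ; ∈-++⁺ʳ; ∈-++⁻; ∈-map⁻; ∈-upTo⁻)
open import Data.List.Relation.Unary.Any as Any using (here; there)
open import Data.List.Relation.Unary.All as All using (All; []; _∷_)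
open import Data.List.Relation.Unary.All.Properties using (++⁻ˡ; ++⁻ʳ)
open import Data.List.Relation.Unary.AllPairs using ([]; _∷_)
open import Data.List.Relation.Unary.Unique.Propositional using (Unique)
import Data.List.Relation.Unary.Unique.Propositional.Properties as Unique
open import Data.List.Relation.Binary.Pointwise as Pointwise using (Pointwise; []; _∷_)
open import Data.List.Relation.Binary.Pointwise.Properties using (lookup-cast)
open import Data.List.Relation.Binary.Sublist.Propositional using (_⊆_; []; _∷_; _∷ʳ_; ⊆-refl; from∈; to∈)
open import Data.List.Relation.Binary.Sublist.Propositional.Properties using (++⁺; ∷ˡ⁻)
open import Data.List.Relation.Binary.Permutation.Propositional
  using (_↭_; ↭-refl; ↭-trans; ↭-sym; prep; swap; ↭⇒↭ₛ)
open import Data.List.Relation.Binary.Permutation.Propositional.Properties using (∈-resp-↭)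
open import Data.Nat using (ℕ; zero; suc; _+_; _<_; _≤_; _∸_; _⊓_; _⊔_; _≤ᵇ_; z≤n; s≤s)
open import Data.Nat.Properties
open import Data.Product using (∃; ∃₂; _×_; _,_; proj₁; proj₂; uncurry′) renaming (swap to ×-swap)
open import Data.Sum using (_⊎_; inj₁; inj₂; [_,_])
open import Data.Unit using (⊤; tt)
open import Function using (_∘_; const)
open import Function.Bundles using (_⇔_; mk⇔; Equivalence)
open import Relation.Binary.Definitions using (Tri; tri<; tri≈; tri>)
open import Relation.Binary.PropositionalEquality
  using (_≡_; _≢_; refl; sym; trans; cong; cong₂; subst; ≢-sym; module ≡-Reasoning)
open import Relation.Binary.PropositionalEquality.Properties using (setoid)
open import Data.List.Relation.Binary.Permutation.Setoid.Properties (setoid ℕ) using (Unique-resp-↭)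

⊆-++⁻ : ∀ (xs : List ℕ) {ys zs} → xs ++ ys ⊆ zs →
  ∃₂ λ zs₁ zs₂ → zs ≡ zs₁ ++ zs₂ × xs ⊆ zs₁ × ys ⊆ zs₂
⊆-++⁻ []       {zs = zs} p = [] , zs , refl , [] , p
⊆-++⁻ (x ∷ xs) (z ∷ʳ p) with zs₁ , zs₂ , eq , p₁ , p₂ ← ⊆-++⁻ (x ∷ xs) p =
  z ∷ zs₁ , zs₂ , cong (z ∷_) eq , z ∷ʳ p₁ , p₂
⊆-++⁻ (x ∷ xs) (refl ∷ p) with zs₁ , zs₂ , eq , p₁ , p₂ ← ⊆-++⁻ xs p =
  x ∷ zs₁ , zs₂ , cong (x ∷_) eq , refl ∷ p₁ , p₂

pair⊆∷ʳ⇒∈ : ∀ (xs : List ℕ) {x y z} → x ∷ y ∷ [] ⊆ xs ++ z ∷ [] → x ∈ xs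
pair⊆∷ʳ⇒∈ []       (_ ∷ʳ ())
pair⊆∷ʳ⇒∈ []       (_ ∷ ())
pair⊆∷ʳ⇒∈ (_ ∷ xs) (_ ∷ʳ p) = there (pair⊆∷ʳ⇒∈ xs p)
pair⊆∷ʳ⇒∈ (_ ∷ xs) (eq ∷ _) = here eq

∈-∈⇒pair⊆ : ∀ {x y} (xs : List ℕ) → x ∈ xs → y ∈ xs → x ≢ y →
  x ∷ y ∷ [] ⊆ xs ⊎ y ∷ x ∷ [] ⊆ xs
∈-∈⇒pair⊆ (_ ∷ xs) (here refl) (here refl) x≢y = ⊥-elim (x≢y refl)
∈-∈⇒pair⊆ (_ ∷ xs) (here refl) (there q)   _   = inj₁ (refl ∷ from∈ q)
∈-∈⇒pair⊆ (_ ∷ xs) (there p)   (here refl) _   = inj₂ (refl ∷ from∈ p)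
∈-∈⇒pair⊆ (z ∷ xs) (there p)   (there q)   x≢y with ∈-∈⇒pair⊆ xs p q x≢y
... | inj₁ s = inj₁ (z ∷ʳ s)
... | inj₂ s = inj₂ (z ∷ʳ s)

Unique-++⁻ˡ : ∀ (xs : List ℕ) {ys} → Unique (xs ++ ys) → Unique xs
Unique-++⁻ˡ []       _         = []
Unique-++⁻ˡ (_ ∷ xs) (x∉ ∷ u) = ++⁻ˡ xs x∉ ∷ Unique-++⁻ˡ xs u

Unique-++⇒≢ : ∀ (xs : List ℕ) {ys x y} → Unique (xs ++ ys) → x ∈ xs → y ∈ ys → x ≢ y
Unique-++⇒≢ (_ ∷ xs) (x∉ ∷ _) (here refl) y∈ = All.lookup x∉ (∈-++⁺ʳ xs y∈)
Unique-++⇒≢ (_ ∷ xs) (_ ∷ u)  (there x∈)  y∈ = Unique-++⇒≢ xs u x∈ y∈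

-- Bubble sort passes

emitted : ℕ → List ℕ → List ℕ
emitted c []       = []
emitted c (x ∷ xs) = c ⊓ x ∷ emitted (c ⊔ x) xs

carried : ℕ → List ℕ → ℕ
carried c []       = c
carried c (x ∷ xs) = carried (c ⊔ x) xs

pass : ℕ → List ℕ → List ℕ
pass c xs = emitted c xs ++ carried c xs ∷ []

bubble : List ℕ → List ℕ
bubble []       = []
bubble (x ∷ xs) = pass x xs

pass-++ : ∀ c xs ys → pass c (xs ++ ys) ≡ emitted c xs ++ pass (carried c xs) ys
pass-++ c []       ys = refl
pass-++ c (x ∷ xs) ys = cong (c ⊓ x ∷_) (pass-++ (c ⊔ x) xs ys)

⊓∷⊔∷-↭ : ∀ c x (xs : List ℕ) → c ⊓ x ∷ c ⊔ x ∷ xs ↭ c ∷ x ∷ xs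
⊓∷⊔∷-↭ c x xs with ≤-total c x
... | inj₁ c≤x rewrite m≤n⇒m⊓n≡m c≤x | m≤n⇒m⊔n≡n c≤x = ↭-refl
... | inj₂ x≤c rewrite m≥n⇒m⊓n≡n x≤c | m≥n⇒m⊔n≡m x≤c = swap x c ↭-refl

pass-↭ : ∀ c xs → pass c xs ↭ c ∷ xs
pass-↭ c []       = ↭-refl
pass-↭ c (x ∷ xs) = ↭-trans (prep (c ⊓ x) (pass-↭ (c ⊔ x) xs)) (⊓∷⊔∷-↭ c x xs)

∈-pass⁻ : ∀ {y} c xs → y ∈ pass c xs → y ∈ c ∷ xs
∈-pass⁻ c xs = ∈-resp-↭ (pass-↭ c xs)

∈-pass⁺ : ∀ {y} c xs → y ∈ c ∷ xs → y ∈ pass c xs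
∈-pass⁺ c xs = ∈-resp-↭ (↭-sym (pass-↭ c xs))

∈-emitted⁻ : ∀ {y} c xs → y ∈ emitted c xs → y ∈ c ∷ xs
∈-emitted⁻ c xs = ∈-pass⁻ c xs ∘ ∈-++⁺ˡ

carried-∈ : ∀ c xs → carried c xs ∈ c ∷ xs
carried-∈ c xs = ∈-pass⁻ c xs (∈-++⁺ʳ (emitted c xs) (here refl))

∈⇒≤carried : ∀ {y} c xs → y ∈ c ∷ xs → y ≤ carried c xs
∈⇒≤carried c []       (here refl)         = ≤-refl
∈⇒≤carried c (x ∷ xs) (here refl)         = ≤-trans (m≤m⊔n c x) (∈⇒≤carried (c ⊔ x) xs (here refl))
∈⇒≤carried c (x ∷ xs) (there (here refl)) = ≤-trans (m≤n⊔m c x) (∈⇒≤carried (c ⊔ x) xs (here refl))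
∈⇒≤carried c (x ∷ xs) (there (there p))   = ∈⇒≤carried (c ⊔ x) xs (there p)

⊓<⊔ : ∀ {c x} → c ≢ x → c ⊓ x < c ⊔ x
⊓<⊔ {c} {x} c≢x with ≤-total c x
... | inj₁ c≤x rewrite m≤n⇒m⊓n≡m c≤x | m≤n⇒m⊔n≡n c≤x = ≤∧≢⇒< c≤x c≢x
... | inj₂ x≤c rewrite m≥n⇒m⊓n≡n x≤c | m≥n⇒m⊔n≡m x≤c = ≤∧≢⇒< x≤c (c≢x ∘ sym)

Unique-⊔ : ∀ {c x xs} → Unique (c ∷ x ∷ xs) → Unique (c ⊔ x ∷ xs)
Unique-⊔ {c} {x} ((_ ∷ c∉) ∷ x∉ ∷ u) with ⊔-sel c x
... | inj₁ eq rewrite eq = c∉ ∷ u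
... | inj₂ eq rewrite eq = x∉ ∷ u

carried-Unique : ∀ c xs {ys} → Unique (c ∷ xs ++ ys) → Unique (carried c xs ∷ ys)
carried-Unique c []       u = u
carried-Unique c (x ∷ xs) u = carried-Unique (c ⊔ x) xs (Unique-⊔ u)

emitted-< : ∀ c xs → Unique (c ∷ xs) → All (_< carried c xs) (emitted c xs)
emitted-< c []       _ = []
emitted-< c (x ∷ xs) u@((c≢x ∷ _) ∷ _) =
  <-≤-trans (⊓<⊔ c≢x) (∈⇒≤carried (c ⊔ x) xs (here refl)) ∷ emitted-< (c ⊔ x) xs (Unique-⊔ u)

⊆-emitted⁺ : ∀ {t} c xs {ys} → t ≤ c → All (_< t) ys → ys ⊆ xs → ys ⊆ emitted c xs
⊆-emitted⁺ c []       _   _          []         = []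
⊆-emitted⁺ c (x ∷ xs) t≤c ys<t       (_ ∷ʳ p)   =
  c ⊓ x ∷ʳ ⊆-emitted⁺ (c ⊔ x) xs (≤-trans t≤c (m≤m⊔n c x)) ys<t p
⊆-emitted⁺ c (x ∷ xs) t≤c (x<t ∷ ys<t) (refl ∷ p) =
  sym (m≥n⇒m⊓n≡n x≤c) ∷ ⊆-emitted⁺ (c ⊔ x) xs (≤-trans t≤c (m≤m⊔n c x)) ys<t p
  where x≤c = <⇒≤ (<-≤-trans x<t t≤c)

⊆-emitted⁻ : ∀ {t} c xs {ys} → t ≤ c → All (_< t) ys → ys ⊆ emitted c xs → ys ⊆ xs
⊆-emitted⁻ c []       _   _          []       = []
⊆-emitted⁻ c (x ∷ xs) t≤c ys<t       (_ ∷ʳ p) =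
  x ∷ʳ ⊆-emitted⁻ (c ⊔ x) xs (≤-trans t≤c (m≤m⊔n c x)) ys<t p
⊆-emitted⁻ c (x ∷ xs) t≤c (y<t ∷ ys<t) (y≡ ∷ p) with ⊓-sel c x
... | inj₁ ⊓≡c = ⊥-elim (<-irrefl (trans y≡ ⊓≡c) (<-≤-trans y<t t≤c))
... | inj₂ ⊓≡x = trans y≡ ⊓≡x ∷ ⊆-emitted⁻ (c ⊔ x) xs (≤-trans t≤c (m≤m⊔n c x)) ys<t p

pass-split⁻ : ∀ c xs L {M y} → y ∈ M → pass c xs ≡ L ++ M →
  ∃₂ λ P S → xs ≡ P ++ S × L ≡ emitted c P × M ≡ pass (carried c P) S
pass-split⁻ c xs       []      _   eq = [] , xs , refl , refl , sym eq
pass-split⁻ c []       (_ ∷ L) {M} y∈M eq with () ← subst (_ ∈_) (++-conicalʳ L M (sym (∷-injectiveʳ eq))) y∈M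
pass-split⁻ c (x ∷ xs) (_ ∷ L) y∈M eq with refl , eq′ ← ∷-injective eq
  with P , S , refl , refl , M≡ ← pass-split⁻ (c ⊔ x) xs L y∈M eq′ = x ∷ P , S , refl , refl , M≡

pass-pair⁻ : ∀ c xs {y z} → y ∷ z ∷ [] ⊆ pass c xs → y < z → ∃ λ f → f ∈ xs × y ≤ f
pass-pair⁻ c xs yz⊆ y<z with ∈-emitted⁻ c xs (pair⊆∷ʳ⇒∈ (emitted c xs) yz⊆)
... | there y∈xs = _ , y∈xs , ≤-refl
... | here refl with ∈-pass⁻ c xs (to∈ (∷ˡ⁻ yz⊆))
...   | here refl   = ⊥-elim (<-irrefl refl y<z)
...   | there z∈xs = _ , z∈xs , <⇒≤ y<z

emitted-above : ∀ {c xs x f} → Unique (c ∷ xs) → x < c → f ∈ xs → x < f →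
  ∃ λ y → y ∈ emitted c xs × x < y
emitted-above {c} {xs} (c∉ ∷ _) x<c f∈ x<f
  with ∈-++⁻ (emitted c xs) (∈-pass⁺ c xs (there f∈)) | ∈-++⁻ (emitted c xs) (∈-pass⁺ c xs (here refl))
... | inj₁ f∈e         | _                = _ , f∈e , x<f
... | inj₂ _           | inj₁ c∈e         = _ , c∈e , x<c
... | inj₂ (here f≡)   | inj₂ (here c≡)   = ⊥-elim (All.lookup c∉ f∈ (trans c≡ (sym f≡)))

record Spread (σ : List ℕ) (x : ℕ) (A : List ℕ) : Set where
  constructor spread
  field
    U V W : List ℕ
    split : σ ≡ U ++ V ++ W
    x∈U   : x ∈ U
    e     : ℕ
    e∈U   : e ∈ U
    x<e   : x < e
    A⊆V   : A ⊆ V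
    f     : ℕ
    f∈W   : f ∈ W
    x<f   : x < f

pass-occurrence⇒Spread : ∀ c xs {x A y z} → Unique (c ∷ xs) → x < y → y < z →
  x ∷ A ++ y ∷ z ∷ [] ⊆ pass c xs → All (_< x) A → Spread (c ∷ xs) x A
pass-occurrence⇒Spread c xs {x} {A} u x<y y<z occ A<x
  with T₁ , T₂₃ , eq₁ , x⊆T₁ , rest ← ⊆-++⁻ (x ∷ []) occ
  with T₂ , T₃ , eq₂ , A⊆T₂ , yz⊆T₃ ← ⊆-++⁻ A rest
  with P₁ , S₁ , refl , refl , eq₃ ←
         pass-split⁻ c xs T₁ (∈-++⁺ʳ T₂ (to∈ yz⊆T₃)) (trans eq₁ (cong (T₁ ++_) eq₂))
  with P₂ , S , refl , refl , refl ← pass-split⁻ (carried c P₁) S₁ T₂ (to∈ yz⊆T₃) (sym eq₃)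
  with f , f∈S , y≤f ← pass-pair⁻ (carried (carried c P₁) P₂) S yz⊆T₃ y<z =
  spread (c ∷ P₁) P₂ S refl (∈-emitted⁻ c P₁ x∈) (carried c P₁) (carried-∈ c P₁) x<e
         (⊆-emitted⁻ (carried c P₁) P₂ (<⇒≤ x<e) A<x A⊆T₂) f f∈S (<-≤-trans x<y y≤f)
  where
  x∈ = to∈ x⊆T₁
  x<e = All.lookup (emitted-< c P₁ (Unique-++⁻ˡ (c ∷ P₁) u)) x∈

Spread⇒pass-occurrence : ∀ c xs {x A} → Unique (c ∷ xs) → All (_< x) A → Spread (c ∷ xs) x A →
  ∃₂ λ y z → x < y × y < z × x ∷ A ++ y ∷ z ∷ [] ⊆ pass c xs
Spread⇒pass-occurrence c xs {x} {A} u A<x (spread (_ ∷ U) V W split x∈U e e∈U x<e A⊆V f f∈W x<f)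
  with refl , refl ← ∷-injective split =
  let y , y∈ , x<y = emitted-above u₂ (<-≤-trans x<c₁ (∈⇒≤carried c₁ V (here refl))) f∈W x<f in
  y , carried c₂ W , x<y , All.lookup (emitted-< c₂ W u₂) y∈ ,
  subst (x ∷ A ++ y ∷ carried c₂ W ∷ [] ⊆_) pass≡
        (++⁺ (from∈ x∈) (++⁺ (⊆-emitted⁺ c₁ V (<⇒≤ x<c₁) A<x A⊆V) (++⁺ (from∈ y∈) ⊆-refl)))
  where
  open ≡-Reasoning
  c₁ = carried c U
  c₂ = carried c₁ V
  u₂ : Unique (c₂ ∷ W)
  u₂ = carried-Unique c₁ V (carried-Unique c U u)
  x<c₁ : x < c₁
  x<c₁ = <-≤-trans x<e (∈⇒≤carried c U e∈U)
  x∈ : x ∈ emitted c U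
  x∈ with ∈-++⁻ (emitted c U) (∈-pass⁺ c U x∈U)
  ... | inj₁ x∈e      = x∈e
  ... | inj₂ (here x≡) = ⊥-elim (<-irrefl x≡ x<c₁)
  pass≡ : emitted c U ++ emitted c₁ V ++ pass c₂ W ≡ pass c (U ++ V ++ W)
  pass≡ = begin
    emitted c U ++ emitted c₁ V ++ pass c₂ W ≡⟨ cong (emitted c U ++_) (pass-++ c₁ V W) ⟨
    emitted c U ++ pass c₁ (V ++ W)          ≡⟨ pass-++ c U (V ++ W) ⟨
    pass c (U ++ V ++ W)                     ∎

pass-≤ : ∀ m xs → All (_≤ m) xs → pass m xs ≡ xs ++ m ∷ []
pass-≤ m []       _            = refl
pass-≤ m (x ∷ xs) (x≤m ∷ xs≤m) rewrite m≥n⇒m⊓n≡n x≤m | m≥n⇒m⊔n≡m x≤m = cong (x ∷_) (pass-≤ m xs xs≤m)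

bubble-split : ∀ m xs ys → All (_< m) xs → All (_≤ m) ys →
  bubble (xs ++ m ∷ ys) ≡ bubble xs ++ ys ++ m ∷ []
bubble-split m []       ys _     ys≤m = pass-≤ m ys ys≤m
bubble-split m (x ∷ xs) ys xs<m ys≤m = begin
  pass x (xs ++ m ∷ ys)                         ≡⟨ pass-++ x xs (m ∷ ys) ⟩
  emitted x xs ++ c ⊓ m ∷ pass (c ⊔ m) ys       ≡⟨ cong₂ (λ a b → emitted x xs ++ a ∷ pass b ys)
                                                          (m≤n⇒m⊓n≡m c≤m) (m≤n⇒m⊔n≡n c≤m) ⟩
  emitted x xs ++ c ∷ pass m ys                 ≡⟨ cong (λ zs → emitted x xs ++ c ∷ zs) (pass-≤ m ys ys≤m) ⟩
  emitted x xs ++ c ∷ ys ++ m ∷ []              ≡⟨ ++-assoc (emitted x xs) (c ∷ []) (ys ++ m ∷ []) ⟨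
  pass x xs ++ ys ++ m ∷ []                     ∎
  where
  open ≡-Reasoning
  c = carried x xs
  c≤m = <⇒≤ (All.lookup xs<m (carried-∈ x xs))

-- B is a bubble sort pass

maxL-≥ : ∀ xs → All (_≤ maxL xs) xs
maxL-≥ []       = []
maxL-≥ (x ∷ xs) = m≤m⊔n x (maxL xs) ∷ All.map (λ y≤ → ≤-trans y≤ (m≤n⊔m x (maxL xs))) (maxL-≥ xs)

maxL-∈ : ∀ x xs → maxL (x ∷ xs) ∈ x ∷ xs
maxL-∈ x []       = here (⊔-identityʳ x)
maxL-∈ x (y ∷ ys) with ⊔-sel x (maxL (y ∷ ys))
... | inj₁ eq = here eq
... | inj₂ eq = there (subst (_∈ y ∷ ys) (sym eq) (maxL-∈ y ys))

≤ᵇ∧≥ᵇ⇒≡ : ∀ {m x} → ((m ≤ᵇ x) ∧ (x ≤ᵇ m)) ≡ true → x ≡ m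
≤ᵇ∧≥ᵇ⇒≡ {m} {x} eq with m≤x , x≤m ← Equivalence.to T-∧ (subst T (sym eq) tt) =
  ≤-antisym (≤ᵇ⇒≤ x m x≤m) (≤ᵇ⇒≤ m x m≤x)

≤ᵇ∧≥ᵇ⇒≢ : ∀ {m x} → ((m ≤ᵇ x) ∧ (x ≤ᵇ m)) ≡ false → x ≢ m
≤ᵇ∧≥ᵇ⇒≢ {m} eq refl = subst T eq (Equivalence.from (T-∧ {m ≤ᵇ m}) (≤⇒≤ᵇ (≤-refl {m}) , ≤⇒≤ᵇ (≤-refl {m})))

splitAt-correct : ∀ m xs → m ∈ xs →
  xs ≡ proj₁ (splitAt m xs) ++ m ∷ proj₂ (splitAt m xs) × All (_≢ m) (proj₁ (splitAt m xs))
splitAt-correct m (x ∷ xs) m∈ with (m ≤ᵇ x) ∧ (x ≤ᵇ m) in eq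
... | true  = cong (_∷ xs) (≤ᵇ∧≥ᵇ⇒≡ eq) , []
... | false with splitAt m xs | splitAt-correct m xs (Any.tail (≢-sym (≤ᵇ∧≥ᵇ⇒≢ eq)) m∈)
...   | (l , r) | (split , l≢m) = cong (x ∷_) split , ≤ᵇ∧≥ᵇ⇒≢ eq ∷ l≢m

Bf≡bubble : ∀ k xs → length xs ≤ k → Bf k xs ≡ bubble xs
Bf≡bubble zero    []       _    = refl
Bf≡bubble (suc k) []       _    = refl
Bf≡bubble (suc k) (x ∷ xs) |xs|≤k
  with splitAt (maxL (x ∷ xs)) (x ∷ xs) | splitAt-correct (maxL (x ∷ xs)) (x ∷ xs) (maxL-∈ x xs)
... | (l , r) | (split , l≢m) = begin
  Bf k l ++ r ++ m ∷ []      ≡⟨ cong (_++ r ++ m ∷ []) (Bf≡bubble k l |l|≤k) ⟩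
  bubble l ++ r ++ m ∷ []    ≡⟨ bubble-split m l r (All.zipWith (uncurry′ ≤∧≢⇒<) (l≤m , l≢m)) r≤m ⟨
  bubble (l ++ m ∷ r)        ≡⟨ cong bubble split ⟨
  bubble (x ∷ xs)            ∎
  where
  open ≡-Reasoning
  m = maxL (x ∷ xs)
  l≤m : All (_≤ m) l
  l≤m = ++⁻ˡ l (subst (All (_≤ m)) split (maxL-≥ (x ∷ xs)))
  r≤m : All (_≤ m) r
  r≤m with _ ∷ r≤m ← ++⁻ʳ l (subst (All (_≤ m)) split (maxL-≥ (x ∷ xs))) = r≤m
  |l|≤k : length l ≤ k
  |l|≤k = ≤-trans (length-++-≤ˡ l)
    (≤-pred (subst (_≤ suc k) (trans (cong length split) (length-++-sucʳ l m r)) |xs|≤k))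

B≡bubble : ∀ σ → B σ ≡ bubble σ
B≡bubble σ = Bf≡bubble (length σ) σ ≤-refl

-- Order isomorphism

SameOrder : ℕ → ℕ → ℕ → ℕ → Set
SameOrder x p y q = (x < y ⇔ p < q) × (y < x ⇔ q < p)

SameOrder-< : ∀ {x p y q} → x < y → p < q → SameOrder x p y q
SameOrder-< x<y p<q =
  mk⇔ (const p<q) (const x<y) ,
  mk⇔ (λ y<x → ⊥-elim (<-asym x<y y<x)) (λ q<p → ⊥-elim (<-asym p<q q<p))

SameOrder-> : ∀ {x p y q} → y < x → q < p → SameOrder x p y q
SameOrder-> y<x q<p = ×-swap (SameOrder-< y<x q<p)

SameOrder⇒< : ∀ {x p y q} → SameOrder x p y q → p < q → x < y
SameOrder⇒< = Equivalence.from ∘ proj₁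

SameOrder⇒> : ∀ {x p y q} → SameOrder x p y q → q < p → y < x
SameOrder⇒> = Equivalence.from ∘ proj₂

-- An inductive form of OrderIso: each entry compares with the later entries as its partner does.
infix 4 _≅_
_≅_ : List ℕ → List ℕ → Set
[]       ≅ []       = ⊤
(x ∷ xs) ≅ (p ∷ ps) = Pointwise (SameOrder x p) xs ps × xs ≅ ps
_        ≅ _        = ⊥

≅-length : ∀ xs ys → xs ≅ ys → length xs ≡ length ys
≅-length []       []       _       = refl
≅-length (_ ∷ xs) (_ ∷ ys) (_ , i) = cong suc (≅-length xs ys i)

Pointwise-cast : ∀ {R : ℕ → ℕ → Set} xs ys (eq : length xs ≡ length ys) →
  (∀ i → R (lookup xs i) (lookup ys (cast eq i))) → Pointwise R xs ys
Pointwise-cast {R} xs ys eq r = Pointwise.lookup⁻ eq λ {i} {j} i≡j →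
  subst (R (lookup xs i) ∘ lookup ys) (toℕ-injective (trans (toℕ-cast eq i) i≡j)) (r i)

OrderIso⇒≅ : ∀ xs ys → OrderIso xs ys → xs ≅ ys
OrderIso⇒≅ []       []       _        = tt
OrderIso⇒≅ (x ∷ xs) (y ∷ ys) (eq , r) =
  Pointwise-cast xs ys (suc-injective eq) (λ i → r zero (suc i) , r (suc i) zero) ,
  OrderIso⇒≅ xs ys (suc-injective eq , λ i j → r (suc i) (suc j))

≅⇒OrderIso : ∀ xs ys → xs ≅ ys → OrderIso xs ys
≅⇒OrderIso []       []       _        = refl , λ ()
≅⇒OrderIso (x ∷ xs) (p ∷ ps) (r , xs≅) = cong suc eq , order
  where
  eq = ≅-length xs ps xs≅
  order : ∀ i j → (lookup (x ∷ xs) i < lookup (x ∷ xs) j) ⇔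
                  (lookup (p ∷ ps) (cast (cong suc eq) i) < lookup (p ∷ ps) (cast (cong suc eq) j))
  order zero    zero    = mk⇔ (⊥-elim ∘ <-irrefl refl) (⊥-elim ∘ <-irrefl refl)
  order zero    (suc j) = proj₁ (lookup-cast r eq j)
  order (suc i) zero    = proj₂ (lookup-cast r eq i)
  order (suc i) (suc j) = proj₂ (≅⇒OrderIso xs ps xs≅) i j

Pointwise-++⁻ : ∀ {R : ℕ → ℕ → Set} xs ys {zs ws} → length xs ≡ length ys →
  Pointwise R (xs ++ zs) (ys ++ ws) → Pointwise R xs ys × Pointwise R zs ws
Pointwise-++⁻ []       []       _  r       = [] , r
Pointwise-++⁻ (_ ∷ xs) (_ ∷ ys) eq (r ∷ rs) with rs₁ , rs₂ ← Pointwise-++⁻ xs ys (suc-injective eq) rs =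
  r ∷ rs₁ , rs₂

All²⇒Pointwise : ∀ {P Q : ℕ → Set} {R : ℕ → ℕ → Set} {xs ys} → length xs ≡ length ys →
  All P xs → All Q ys → (∀ {x y} → P x → Q y → R x y) → Pointwise R xs ys
All²⇒Pointwise {xs = []}    {[]}    _  []       []       _ = []
All²⇒Pointwise {xs = _ ∷ _} {_ ∷ _} eq (p ∷ ps) (q ∷ qs) r = r p q ∷ All²⇒Pointwise (suc-injective eq) ps qs r

Pointwise⇒All : ∀ {P Q : ℕ → Set} {R : ℕ → ℕ → Set} {xs ys} →
  Pointwise R xs ys → All Q ys → (∀ {x y} → R x y → Q y → P x) → All P xs
Pointwise⇒All []       []       _ = []
Pointwise⇒All (r ∷ rs) (q ∷ qs) h = h r q ∷ Pointwise⇒All rs qs h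

Across : List ℕ → List ℕ → List ℕ → List ℕ → Set
Across A T α Π = Pointwise (λ a p → Pointwise (SameOrder a p) T Π) A α

≅-++⁻ : ∀ α Π τ → τ ≅ α ++ Π →
  ∃₂ λ A T → τ ≡ A ++ T × A ≅ α × T ≅ Π × Across A T α Π
≅-++⁻ []      Π τ       τ≅ = [] , τ , refl , tt , τ≅ , []
≅-++⁻ (p ∷ α) Π (a ∷ τ) (r , τ≅)
  with A , T , refl , A≅ , T≅ , across ← ≅-++⁻ α Π τ τ≅
  with rA , rT ← Pointwise-++⁻ A α (≅-length A α A≅) r =
  a ∷ A , T , refl , (rA , A≅) , T≅ , rT ∷ across

≅-++⁺ : ∀ A α T Π → A ≅ α → T ≅ Π → Across A T α Π → A ++ T ≅ α ++ Π
≅-++⁺ []      []      T Π _          T≅ _          = T≅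
≅-++⁺ (_ ∷ A) (_ ∷ α) T Π (rA , A≅) T≅ (rT ∷ across) =
  Pointwise.++⁺ rA rT , ≅-++⁺ A α T Π A≅ T≅ across

-- The patterns

≅-pair⁻ : ∀ T {b d} → T ≅ b ∷ d ∷ [] → ∃₂ λ y z → T ≡ y ∷ z ∷ [] × SameOrder y b z d
≅-pair⁻ (y ∷ z ∷ [])    (r ∷ [] , _) = y , z , refl , r
≅-pair⁻ []              ()
≅-pair⁻ (_ ∷ [])        (() , _)
≅-pair⁻ (_ ∷ _ ∷ _ ∷ _) (_ ∷ () , _)

≅-singleton⁻ : ∀ T {w} → T ≅ w ∷ [] → ∃ λ g → T ≡ g ∷ []
≅-singleton⁻ (g ∷ [])    _        = g , refl
≅-singleton⁻ []          ()
≅-singleton⁻ (_ ∷ _ ∷ _) (() , _)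

≅-cαbd⁻ : ∀ {α c b d} τ → All (_< c) α → c < b → b < d → τ ≅ c ∷ α ++ b ∷ d ∷ [] →
  ∃₂ λ x A → ∃₂ λ y z → τ ≡ x ∷ A ++ y ∷ z ∷ [] × A ≅ α × All (_< x) A × x < y × y < z
≅-cαbd⁻ []      _ _ _ ()
≅-cαbd⁻ {α} {b = b} {d} (x ∷ τ) α<c c<b b<d (r , τ≅)
  with A , T , refl , A≅ , T≅ , _ ← ≅-++⁻ α (b ∷ d ∷ []) τ τ≅
  with y , z , refl , y~z ← ≅-pair⁻ T T≅
  with rA , x~y ∷ _ ← Pointwise-++⁻ A α (≅-length A α A≅) r =
  x , A , y , z , refl , A≅ , Pointwise⇒All rA α<c SameOrder⇒> ,
  SameOrder⇒< x~y c<b , SameOrder⇒< y~z b<d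

≅-cαbd⁺ : ∀ {α c b d x A y z} → A ≅ α → All (_< c) α → All (_< x) A → c < b → b < d → x < y → y < z →
  x ∷ A ++ y ∷ z ∷ [] ≅ c ∷ α ++ b ∷ d ∷ []
≅-cαbd⁺ {α} {A = A} {y} {z} A≅ α<c A<x c<b b<d x<y y<z =
  Pointwise.++⁺ (All²⇒Pointwise |A| A<x α<c SameOrder->)
                (SameOrder-< x<y c<b ∷ SameOrder-< (<-trans x<y y<z) (<-trans c<b b<d) ∷ []) ,
  ≅-++⁺ A α (y ∷ z ∷ []) _ A≅ (SameOrder-< y<z b<d ∷ [] , [] , tt)
    (All²⇒Pointwise |A| A<x α<c λ a<x p<c →
      SameOrder-< (<-trans a<x x<y) (<-trans p<c c<b) ∷
      SameOrder-< (<-trans a<x (<-trans x<y y<z)) (<-trans p<c (<-trans c<b b<d)) ∷ [])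
  where |A| = ≅-length A α A≅

≅-uvαw⁻ : ∀ {α u v w} τ → All (_< u) α → All (_< v) α → τ ≅ u ∷ v ∷ α ++ w ∷ [] →
  ∃₂ λ s t → ∃₂ λ A g → τ ≡ s ∷ t ∷ A ++ g ∷ [] × A ≅ α × All (_< s) A × All (_< t) A ×
    SameOrder s u t v × SameOrder s u g w × SameOrder t v g w
≅-uvαw⁻ []      _ _ ()
≅-uvαw⁻ (_ ∷ []) _ _ (() , _)
≅-uvαw⁻ {α} {w = w} (s ∷ t ∷ τ) α<u α<v (s~t ∷ rs , rt , τ≅)
  with A , T , refl , A≅ , T≅ , _ ← ≅-++⁻ α (w ∷ []) τ τ≅
  with g , refl ← ≅-singleton⁻ T T≅
  with rsA , s~g ∷ [] ← Pointwise-++⁻ A α (≅-length A α A≅) rs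
  with rtA , t~g ∷ [] ← Pointwise-++⁻ A α (≅-length A α A≅) rt =
  s , t , A , g , refl , A≅ , Pointwise⇒All rsA α<u SameOrder⇒> , Pointwise⇒All rtA α<v SameOrder⇒> ,
  s~t , s~g , t~g

≅-uvαw⁺ : ∀ {α u v w s t A g} → A ≅ α → All (_< u) α → All (_< v) α → All (_< w) α →
  All (_< s) A → All (_< t) A → All (_< g) A →
  SameOrder s u t v → SameOrder s u g w → SameOrder t v g w →
  s ∷ t ∷ A ++ g ∷ [] ≅ u ∷ v ∷ α ++ w ∷ []
≅-uvαw⁺ {α} {A = A} {g} A≅ α<u α<v α<w A<s A<t A<g s~t s~g t~g =
  s~t ∷ Pointwise.++⁺ (All²⇒Pointwise |A| A<s α<u SameOrder->) (s~g ∷ []) ,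
  Pointwise.++⁺ (All²⇒Pointwise |A| A<t α<v SameOrder->) (t~g ∷ []) ,
  ≅-++⁺ A α (g ∷ []) _ A≅ ([] , tt) (All²⇒Pointwise |A| A<g α<w λ a<g p<w → SameOrder-< a<g p<w ∷ [])
  where |A| = ≅-length A α A≅

module _ (α : List ℕ) {c b d : ℕ} (α<c : All (_< c) α) (c<b : c < b) (b<d : b < d) where

  private
    c<d = <-trans c<b b<d
    α<b = All.map (λ a<c → <-trans a<c c<b) α<c
    α<d = All.map (λ a<c → <-trans a<c c<d) α<c

  CopySpread : List ℕ → Set
  CopySpread σ = ∃₂ λ x A → A ≅ α × All (_< x) A × Spread σ x A

  B-contains-π⇒CopySpread : ∀ s xs → Unique (s ∷ xs) →
    Contains (B (s ∷ xs)) (c ∷ α ++ b ∷ d ∷ []) → CopySpread (s ∷ xs)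
  B-contains-π⇒CopySpread s xs u (τ , τ⊆ , τ≃)
    with x , A , y , z , refl , A≅ , A<x , x<y , y<z ← ≅-cαbd⁻ τ α<c c<b b<d (OrderIso⇒≅ τ _ τ≃) =
    x , A , A≅ , A<x ,
    pass-occurrence⇒Spread s xs u x<y y<z (subst (τ ⊆_) (B≡bubble (s ∷ xs)) τ⊆) A<x

  CopySpread⇒B-contains-π : ∀ s xs → Unique (s ∷ xs) → CopySpread (s ∷ xs) →
    Contains (B (s ∷ xs)) (c ∷ α ++ b ∷ d ∷ [])
  CopySpread⇒B-contains-π s xs u (x , A , A≅ , A<x , sp)
    with y , z , x<y , y<z , occ ← Spread⇒pass-occurrence s xs u A<x sp =
    _ , subst (_ ⊆_) (sym (B≡bubble (s ∷ xs))) occ , ≅⇒OrderIso _ _ (≅-cαbd⁺ A≅ α<c A<x c<b b<d x<y y<z)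

  record Occurrence (σ : List ℕ) (u v w : ℕ) : Set where
    constructor occurrence
    field
      U V W : List ℕ
      split : σ ≡ U ++ V ++ W
      s t g : ℕ
      A     : List ℕ
      s∈U   : s ∈ U
      t∈U   : t ∈ U
      A⊆V   : A ⊆ V
      g∈W   : g ∈ W
      A≅α   : A ≅ α
      A<s   : All (_< s) A
      A<t   : All (_< t) A
      s~t   : SameOrder s u t v
      s~g   : SameOrder s u g w
      t~g   : SameOrder t v g w

  Contains⇒Occurrence : ∀ {σ u v w} → All (_< u) α → All (_< v) α →
    Contains σ (u ∷ v ∷ α ++ w ∷ []) → Occurrence σ u v w
  Contains⇒Occurrence α<u α<v (τ , τ⊆ , τ≃)
    with s , t , A , g , refl , A≅ , A<s , A<t , s~t , s~g , t~g ← ≅-uvαw⁻ τ α<u α<v (OrderIso⇒≅ τ _ τ≃)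
    with U , VW , refl , st⊆U , Ag⊆VW ← ⊆-++⁻ (s ∷ t ∷ []) τ⊆
    with V , W , refl , A⊆V , g⊆W ← ⊆-++⁻ A Ag⊆VW =
    occurrence U V W refl s t g A (to∈ st⊆U) (to∈ (∷ˡ⁻ st⊆U)) A⊆V (to∈ g⊆W) A≅ A<s A<t s~t s~g t~g

  c-first⇒CopySpread : ∀ {σ v w} → c < v → c < w → Contains σ (c ∷ v ∷ α ++ w ∷ []) → CopySpread σ
  c-first⇒CopySpread c<v c<w occ
    with occurrence U V W split s t g A s∈U t∈U A⊆V g∈W A≅ A<s _ s~t s~g _ ←
           Contains⇒Occurrence α<c (All.map (λ a<c → <-trans a<c c<v) α<c) occ =
    s , A , A≅ , A<s , spread U V W split s∈U t t∈U (SameOrder⇒< s~t c<v) A⊆V g g∈W (SameOrder⇒< s~g c<w)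

  c-second⇒CopySpread : ∀ {σ u w} → c < u → c < w → Contains σ (u ∷ c ∷ α ++ w ∷ []) → CopySpread σ
  c-second⇒CopySpread c<u c<w occ
    with occurrence U V W split s t g A s∈U t∈U A⊆V g∈W A≅ _ A<t s~t _ t~g ←
           Contains⇒Occurrence (All.map (λ a<c → <-trans a<c c<u) α<c) α<c occ =
    t , A , A≅ , A<t , spread U V W split t∈U s s∈U (SameOrder⇒> s~t c<u) A⊆V g g∈W (SameOrder⇒< t~g c<w)

  blocks⇒Contains : ∀ {σ u v w U V W s t A g} → σ ≡ U ++ V ++ W →
    s ∷ t ∷ [] ⊆ U → A ⊆ V → g ∈ W → A ≅ α → All (_< u) α → All (_< v) α → All (_< w) α →
    All (_< s) A → All (_< t) A → All (_< g) A →
    SameOrder s u t v → SameOrder s u g w → SameOrder t v g w → Contains σ (u ∷ v ∷ α ++ w ∷ [])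
  blocks⇒Contains refl st⊆U A⊆V g∈W A≅ α<u α<v α<w A<s A<t A<g s~t s~g t~g =
    _ , ++⁺ st⊆U (++⁺ A⊆V (from∈ g∈W)) , ≅⇒OrderIso _ _ (≅-uvαw⁺ A≅ α<u α<v α<w A<s A<t A<g s~t s~g t~g)

  ContainsOneOfFour : List ℕ → Set
  ContainsOneOfFour σ =
    Contains σ (c ∷ b ∷ α ++ d ∷ []) ⊎ Contains σ (b ∷ c ∷ α ++ d ∷ []) ⊎
    Contains σ (c ∷ d ∷ α ++ b ∷ []) ⊎ Contains σ (d ∷ c ∷ α ++ b ∷ [])

  CopySpread⇒contains-one-of-four : ∀ {σ} → Unique σ → CopySpread σ → ContainsOneOfFour σ
  CopySpread⇒contains-one-of-four {σ} u (x , A , A≅ , A<x , spread U V W split x∈U e e∈U x<e A⊆V f f∈W x<f) =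
    cases (∈-∈⇒pair⊆ U x∈U e∈U (<⇒≢ x<e)) (<-cmp e f)
    where
    A<e = All.map (λ a<x → <-trans a<x x<e) A<x
    A<f = All.map (λ a<x → <-trans a<x x<f) A<x
    e≢f : e ≢ f
    e≢f = Unique-++⇒≢ U (subst Unique split u) e∈U (∈-++⁺ʳ V f∈W)
    cases : x ∷ e ∷ [] ⊆ U ⊎ e ∷ x ∷ [] ⊆ U → Tri (e < f) (e ≡ f) (f < e) → ContainsOneOfFour σ
    cases (inj₁ xe) (tri< e<f _ _) = inj₁ (blocks⇒Contains split xe A⊆V f∈W A≅ α<c α<b α<d A<x A<e A<f
      (SameOrder-< x<e c<b) (SameOrder-< x<f c<d) (SameOrder-< e<f b<d))
    cases (inj₂ ex) (tri< e<f _ _) = inj₂ (inj₁ (blocks⇒Contains split ex A⊆V f∈W A≅ α<b α<c α<d A<e A<x A<f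
      (SameOrder-> x<e c<b) (SameOrder-< e<f b<d) (SameOrder-< x<f c<d)))
    cases (inj₁ xe) (tri> _ _ f<e) = inj₂ (inj₂ (inj₁ (blocks⇒Contains split xe A⊆V f∈W A≅ α<c α<d α<b A<x A<e A<f
      (SameOrder-< x<e c<d) (SameOrder-< x<f c<b) (SameOrder-> f<e b<d))))
    cases (inj₂ ex) (tri> _ _ f<e) = inj₂ (inj₂ (inj₂ (blocks⇒Contains split ex A⊆V f∈W A≅ α<d α<c α<b A<e A<x A<f
      (SameOrder-> x<e c<d) (SameOrder-> f<e b<d) (SameOrder-< x<f c<b))))
    cases _ (tri≈ _ e≡f _) = ⊥-elim (e≢f e≡f)

  B-avoids⇔avoids-four : ∀ s xs → Unique (s ∷ xs) →
    Avoids ((c ∷ α ++ b ∷ d ∷ []) ∷ []) (B (s ∷ xs)) ⇔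
    Avoids ((c ∷ b ∷ α ++ d ∷ []) ∷ (b ∷ c ∷ α ++ d ∷ []) ∷ (c ∷ d ∷ α ++ b ∷ []) ∷ (d ∷ c ∷ α ++ b ∷ []) ∷ [])
           (s ∷ xs)
  B-avoids⇔avoids-four s xs u = mk⇔
    (λ { (¬π ∷ []) →
      (¬π ∘ lift ∘ c-first⇒CopySpread c<b c<d) ∷ (¬π ∘ lift ∘ c-second⇒CopySpread c<b c<d) ∷
      (¬π ∘ lift ∘ c-first⇒CopySpread c<d c<b) ∷ (¬π ∘ lift ∘ c-second⇒CopySpread c<d c<b) ∷ [] })
    (λ { (¬π₁ ∷ ¬π₂ ∷ ¬π₃ ∷ ¬π₄ ∷ []) →
      ([ ¬π₁ , [ ¬π₂ , [ ¬π₃ , ¬π₄ ] ] ] ∘ CopySpread⇒contains-one-of-four u ∘ B-contains-π⇒CopySpread s xs u) ∷ [] })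
    where
    lift : CopySpread (s ∷ xs) → Contains (B (s ∷ xs)) (c ∷ α ++ b ∷ d ∷ [])
    lift = CopySpread⇒B-contains-π s xs u

∈-oneTo⁻ : ∀ {x n} → x ∈ oneTo n → 1 ≤ x × x ≤ n
∈-oneTo⁻ x∈ with i , i∈ , refl ← ∈-map⁻ suc x∈ = s≤s z≤n , ∈-upTo⁻ i∈

IsPerm⇒Unique : ∀ {n σ} → IsPerm n σ → Unique σ
IsPerm⇒Unique {n} σ↭ = Unique-resp-↭ (↭⇒↭ₛ (↭-sym σ↭)) (Unique.map⁺ suc-injective (Unique.upTo⁺ n))

IsPerm⇒below-head : ∀ k α →
  IsPerm (3 + k) (suc k ∷ α ++ 2 + k ∷ 3 + k ∷ []) → All (_< suc k) α
IsPerm⇒below-head k α π↭ = All.tabulate below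
  where
  below : ∀ {a} → a ∈ α → a < suc k
  below {a} a∈α with k+1∉ ∷ u ← IsPerm⇒Unique π↭ = ≤∧≢⇒< a≤k+1 (≢-sym (All.lookup k+1∉ (∈-++⁺ˡ a∈α)))
    where
    a≢ : ∀ {b} → b ∈ 2 + k ∷ 3 + k ∷ [] → a ≢ b
    a≢ = Unique-++⇒≢ α u a∈α
    a≤k+3 = proj₂ (∈-oneTo⁻ (∈-resp-↭ π↭ (there (∈-++⁺ˡ a∈α))))
    a≤k+2 = ≤-pred (≤∧≢⇒< a≤k+3 (a≢ (there (here refl))))
    a≤k+1 = ≤-pred (≤∧≢⇒< a≤k+2 (a≢ (here refl)))

proposition2p12 : (n : ℕ) (α : List ℕ) →
    IsPerm n ((n ∸ 2) ∷ α ++ ((n ∸ 1) ∷ n ∷ [])) →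
    (m : ℕ) → 1 ≤ m → (σ : List ℕ) → IsPerm m σ →
    Avoids (((n ∸ 2) ∷ α ++ ((n ∸ 1) ∷ n ∷ [])) ∷ []) (B σ)
      ⇔ Avoids (((n ∸ 2) ∷ (n ∸ 1) ∷ α ++ (n ∷ []))
               ∷ ((n ∸ 1) ∷ (n ∸ 2) ∷ α ++ (n ∷ []))
               ∷ ((n ∸ 2) ∷ n ∷ α ++ ((n ∸ 1) ∷ []))
               ∷ (n ∷ (n ∸ 2) ∷ α ++ ((n ∸ 1) ∷ []))
               ∷ []) σ
-- For n ≤ 2 the entry n ∸ 2 is 0, which does not occur in a permutation.
proposition2p12 0 α π↭ _ _ _ _ with () ← proj₁ (∈-oneTo⁻ (∈-resp-↭ π↭ (here refl)))
proposition2p12 1 α π↭ _ _ _ _ with () ← proj₁ (∈-oneTo⁻ (∈-resp-↭ π↭ (here refl)))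
proposition2p12 2 α π↭ _ _ _ _ with () ← proj₁ (∈-oneTo⁻ (∈-resp-↭ π↭ (here refl)))
proposition2p12 (suc (suc (suc k))) α π↭ 0 () _ _
proposition2p12 (suc (suc (suc k))) α π↭ (suc m) _ [] σ↭ with () ← ∈-resp-↭ (↭-sym σ↭) (here refl)
proposition2p12 (suc (suc (suc k))) α π↭ (suc m) _ (s ∷ xs) σ↭ =
  B-avoids⇔avoids-four α (IsPerm⇒below-head k α π↭) ≤-refl ≤-refl s xs (IsPerm⇒Unique σ↭)
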